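{- Let $G$ be a tripartite graph on $n$ vertices. Then \[t_{\max}(G)\ge\begin{cases}\frac{3}{2}\left(e(G)-\frac{n^2}{4}\right) & \text{if } \frac{e(G)}{n^2}<\frac{3}{10},\\[4pt] e(G)-\frac{2}{9}n^2 & \text{if } \frac{3}{10}\le \frac{e(G)}{n^2}\le\frac{1}{3}.\end{cases}\]
   Context: For a graph $G$, the triangle-degree of a vertex $x$ is the number of triangles of $G$ containing $x$, and $t_{\max}(G)$ denotes the maximum triangle-degree over all vertices of $G$. A graph is tripartite if its vertex set can be partitioned into three independent sets. -}

module Defs where

open import Data.Nat using (ℕ; zero; suc; _+_; _*_; _⊔_; _<ᵇ_)
open import Data.Bool using (Bool; true; false; _∧_; if_then_else_)
open import Data.Fin using (Fin; toℕ)
open import Data.List using (List; map; foldr)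
open import Data.Nat.ListAction using (sum)
open import Data.Empty using (⊥)
open import Data.List using () renaming (allFin to allFinL)
open import Data.Product using (∃; _,_)
open import Relation.Binary.PropositionalEquality using (_≡_)

record Graph (n : ℕ) : Set where
  field
    adj   : Fin n → Fin n → Bool
    sym   : ∀ x y → adj x y ≡ adj y x
    irrefl : ∀ x → adj x x ≡ false
open Graph public

Σv : ∀ {n} → (Fin n → ℕ) → ℕ
Σv {n} f = sum (map f (allFinL n))

[_] : Bool → ℕ
[ b ] = if b then 1 else 0

e : ∀ {n} → Graph n → ℕ
e G = Σv λ x → Σv λ y → [ (toℕ x <ᵇ toℕ y) ∧ adj G x y ]

tdeg : ∀ {n} → Graph n → Fin n → ℕ
tdeg G x = Σv λ y → Σv λ z →
  [ (toℕ y <ᵇ toℕ z) ∧ adj G x y ∧ adj G x z ∧ adj G y z ]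

tmax : ∀ {n} → Graph n → ℕ
tmax {n} G = foldr _⊔_ 0 (map (tdeg G) (allFinL n))

Tripartite : ∀ {n} → Graph n → Set
Tripartite {n} G = ∃ λ (c : Fin n → Fin 3) →
  ∀ x y → adj G x y ≡ true → c x ≡ c y → ⊥

-- For a proper 3-colouring with classes V₁, V₂, V₃ of sizes a ≤ b ≤ c, let E_ij be the number
-- of edges between V_i and V_j.  For x ∈ V₁, y ∈ V₂, z ∈ V₃ at most two of the pairs xy, xz, yz
-- are edges unless xyz is a triangle; summing over all such triples gives
-- c E₁₂ + b E₁₃ + a E₂₃ ≤ 2abc + a t_max, and with E₁₃ ≤ ac, E₂₃ ≤ bc this becomes
-- c e ≤ a t_max + c²(a + b).  Both bounds follow from this inequality by polynomial estimates in
-- a ≤ b ≤ c (when a = 0 the graph is bipartite and e ≤ n²/4 suffices).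
module Submission where

open import Defs renaming (sym to adj-sym)
open import Data.Nat using (ℕ; zero; suc; _+_; _*_; _≤_; _<_; _<ᵇ_; _⊔_; z≤n; NonZero)
open import Data.Nat.Properties hiding (_≟_)
open import Data.Nat.Tactic.RingSolver using (solve-∀; solve)
open import Data.Bool using (true; false; _∧_)
open import Data.Bool.Properties using (∧-zeroʳ)
open import Data.Fin using (Fin; zero; suc; toℕ; _≟_)
open import Data.Fin.Patterns using (0F; 1F; 2F)
open import Data.Fin.Properties using (toℕ-injective)
open import Data.Fin.Permutation as Perm
  using (Permutation′; _⟨$⟩ʳ_; _⟨$⟩ˡ_; inverseˡ; inverseʳ; transpose; _∘ₚ_)
open import Data.Product using (∃; _×_; _,_)
open import Data.Sum using (inj₁; inj₂; [_,_]′)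
open import Data.List using (List; []; _∷_; map; foldr; tabulate)
open import Data.List.Properties using (map-tabulate)
open import Data.List.Membership.Propositional using (_∈_)
open import Data.List.Membership.Propositional.Properties using (∈-allFin)
open import Data.List.Relation.Unary.Any using (here; there)
import Data.Nat.ListAction as List
open import Data.Empty using (⊥; ⊥-elim)
open import Function using (_∘_)
open import Relation.Binary.PropositionalEquality hiding ([_])
open import Relation.Nullary using (yes; no; does)
open import Relation.Nullary.Decidable using (dec-false)
open import Algebra.Properties.Semiring.Sum +-*-semiring
  using ( sum; sum-syntax; sum-cong-≗; sum-replicate-zero; ∑-distrib-+; ∑-comm
        ; *-distribˡ-sum; *-distribʳ-sum)
open import Algebra.Properties.CommutativeSemigroup *-commutativeSemigroup
  using () renaming (x∙yz≈y∙xz to x*[y*z]≡y*[x*z])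

private variable
  n : ℕ

[b∧c]≡[b]*[c] : ∀ b c → [ b ∧ c ] ≡ [ b ] * [ c ]
[b∧c]≡[b]*[c] true  c = sym (+-identityʳ [ c ])
[b∧c]≡[b]*[c] false c = refl

[b]≤1 : ∀ b → [ b ] ≤ 1
[b]≤1 true  = ≤-refl
[b]≤1 false = z≤n

[p]+[q]+[r]≤2+[p∧q∧r] : ∀ p q r → [ p ] + [ q ] + [ r ] ≤ 2 + [ p ∧ q ∧ r ]
[p]+[q]+[r]≤2+[p∧q∧r] true  true  true  = ≤-refl
[p]+[q]+[r]≤2+[p∧q∧r] true  true  false = ≤-refl
[p]+[q]+[r]≤2+[p∧q∧r] true  false r     = +-monoʳ-≤ 1 ([b]≤1 r)
[p]+[q]+[r]≤2+[p∧q∧r] false q     r     = +-mono-≤ ([b]≤1 q) ([b]≤1 r)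

∧-swapˡ : ∀ p q r → p ∧ q ∧ r ≡ q ∧ p ∧ r
∧-swapˡ true  q r = refl
∧-swapˡ false q r = sym (∧-zeroʳ q)

[<ᵇ]+[>ᵇ]≡1 : ∀ {m n} → m ≢ n → [ m <ᵇ n ] + [ n <ᵇ m ] ≡ 1
[<ᵇ]+[>ᵇ]≡1 {zero}  {zero}  m≢n = ⊥-elim (m≢n refl)
[<ᵇ]+[>ᵇ]≡1 {zero}  {suc n} m≢n = refl
[<ᵇ]+[>ᵇ]≡1 {suc m} {zero}  m≢n = refl
[<ᵇ]+[>ᵇ]≡1 {suc m} {suc n} m≢n = [<ᵇ]+[>ᵇ]≡1 (m≢n ∘ cong suc)

[n<ᵇn]≡0 : ∀ n → [ n <ᵇ n ] ≡ 0
[n<ᵇn]≡0 zero    = refl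
[n<ᵇn]≡0 (suc n) = [n<ᵇn]≡0 n

-- Finite sums

Σv≡∑ : ∀ (f : Fin n → ℕ) → Σv f ≡ ∑[ x < n ] f x
Σv≡∑ {n} f = trans (cong List.sum (map-tabulate (λ x → x) f)) (sum-tabulate f)
  where
  sum-tabulate : ∀ {n} (f : Fin n → ℕ) → List.sum (tabulate f) ≡ sum f
  sum-tabulate {zero} f = refl
  sum-tabulate {suc n} f = cong (f zero +_) (sum-tabulate (λ x → f (suc x)))

Σv²≡∑² : ∀ (f : Fin n → Fin n → ℕ) → Σv (λ x → Σv (f x)) ≡ ∑[ x < n ] ∑[ y < n ] f x y
Σv²≡∑² f = trans (Σv≡∑ (λ x → Σv (f x))) (sum-cong-≗ (λ x → Σv≡∑ (f x)))

∑∑-distrib-+ : ∀ {m} (f g : Fin n → Fin m → ℕ) →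
               ∑[ x < n ] ∑[ y < m ] (f x y + g x y)
               ≡ ∑[ x < n ] ∑[ y < m ] f x y + ∑[ x < n ] ∑[ y < m ] g x y
∑∑-distrib-+ {m = m} f g = trans (sum-cong-≗ (λ x → ∑-distrib-+ (f x) (g x)))
  (∑-distrib-+ (λ x → ∑[ y < m ] f x y) (λ x → ∑[ y < m ] g x y))

∑-mono-≤ : ∀ {f g : Fin n → ℕ} → (∀ x → f x ≤ g x) → ∑[ x < n ] f x ≤ ∑[ x < n ] g x
∑-mono-≤ {zero} f≤g = z≤n
∑-mono-≤ {suc n} f≤g = +-mono-≤ (f≤g zero) (∑-mono-≤ (λ x → f≤g (suc x)))

∑-const : ∀ n k → ∑[ x < n ] k ≡ n * k
∑-const zero k = refl
∑-const (suc n) k = cong (k +_) (∑-const n k)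

lt : Fin n → Fin n → ℕ
lt x y = [ toℕ x <ᵇ toℕ y ]

split-by-order : ∀ (h : Fin n → Fin n → ℕ) → (∀ x → h x x ≡ 0) →
                 ∀ x y → h x y ≡ lt x y * h x y + lt y x * h x y
split-by-order h h-diag x y with x ≟ y
... | yes refl = begin
  h x x                               ≡⟨ h-diag x ⟩
  0                                   ≡⟨ cong (λ k → k * h x x + k * h x x) ([n<ᵇn]≡0 (toℕ x)) ⟨
  lt x x * h x x + lt x x * h x x     ∎
  where open ≡-Reasoning
... | no x≢y = begin
  h x y                               ≡⟨ *-identityˡ (h x y) ⟨
  1 * h x y                           ≡⟨ cong (_* h x y) ([<ᵇ]+[>ᵇ]≡1 (x≢y ∘ toℕ-injective)) ⟨
  (lt x y + lt y x) * h x y           ≡⟨ *-distribʳ-+ (h x y) (lt x y) (lt y x) ⟩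
  lt x y * h x y + lt y x * h x y     ∎
  where open ≡-Reasoning

∑∑-symmetric : ∀ (h : Fin n → Fin n → ℕ) → (∀ x y → h x y ≡ h y x) → (∀ x → h x x ≡ 0) →
               ∑[ x < n ] ∑[ y < n ] h x y ≡ 2 * (∑[ x < n ] ∑[ y < n ] (lt x y * h x y))
∑∑-symmetric {n} h h-sym h-diag = begin
  ∑[ x < n ] ∑[ y < n ] h x y
    ≡⟨ sum-cong-≗ (λ x → sum-cong-≗ (split-by-order h h-diag x)) ⟩
  ∑[ x < n ] ∑[ y < n ] (lt x y * h x y + lt y x * h x y)
    ≡⟨ ∑∑-distrib-+ (λ x y → lt x y * h x y) (λ x y → lt y x * h x y) ⟩
  U + ∑[ x < n ] ∑[ y < n ] (lt y x * h x y)
    ≡⟨ cong (U +_) (∑-comm (λ x y → lt y x * h x y)) ⟩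
  U + ∑[ y < n ] ∑[ x < n ] (lt y x * h x y)
    ≡⟨ cong (U +_) (sum-cong-≗ λ y → sum-cong-≗ λ x → cong (lt y x *_) (h-sym x y)) ⟩
  U + U
    ≡⟨ cong (U +_) (+-identityʳ U) ⟨
  2 * U ∎
  where
  open ≡-Reasoning
  U = ∑[ x < n ] ∑[ y < n ] (lt x y * h x y)

wsum : (Fin n → ℕ) → (Fin n → ℕ) → ℕ
wsum {n} w f = ∑[ x < n ] (w x * f x)

module _ (w : Fin n → ℕ) where

  wsum-mono-≤ : ∀ {f g} → (∀ x → f x ≤ g x) → wsum w f ≤ wsum w g
  wsum-mono-≤ f≤g = ∑-mono-≤ (λ x → *-monoʳ-≤ (w x) (f≤g x))

  wsum-distrib-+ : ∀ f g → wsum w (λ x → f x + g x) ≡ wsum w f + wsum w g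
  wsum-distrib-+ f g = trans (sum-cong-≗ (λ x → *-distribˡ-+ (w x) (f x) (g x)))
                             (∑-distrib-+ (λ x → w x * f x) (λ x → w x * g x))

  wsum-const : ∀ m → wsum w (λ _ → m) ≡ sum w * m
  wsum-const m = sym (*-distribʳ-sum m w)

  wsum-scale : ∀ m f → wsum w (λ x → m * f x) ≡ m * wsum w f
  wsum-scale m f = trans (sum-cong-≗ (λ x → x*[y*z]≡y*[x*z] (w x) m (f x)))
                         (sym (*-distribˡ-sum m (λ x → w x * f x)))

  wsum-nested : ∀ (v : Fin n → ℕ) (f : Fin n → Fin n → ℕ) →
                wsum w (λ y → wsum v (f y)) ≡ ∑[ y < n ] ∑[ z < n ] (w y * (v z * f y z))
  wsum-nested v f = sum-cong-≗ (λ y → *-distribˡ-sum (w y) (λ z → v z * f y z))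

wsum-comm : ∀ (u v : Fin n → ℕ) (f : Fin n → Fin n → ℕ) →
            wsum u (λ y → wsum v (f y)) ≡ wsum v (λ z → wsum u (λ y → f y z))
wsum-comm {n} u v f = begin
  wsum u (λ y → wsum v (f y))                   ≡⟨ wsum-nested u v f ⟩
  ∑[ y < n ] ∑[ z < n ] (u y * (v z * f y z))   ≡⟨ ∑-comm (λ y z → u y * (v z * f y z)) ⟩
  ∑[ z < n ] ∑[ y < n ] (u y * (v z * f y z))
    ≡⟨ sum-cong-≗ (λ z → sum-cong-≗ (λ y → x*[y*z]≡y*[x*z] (u y) (v z) (f y z))) ⟩
  ∑[ z < n ] ∑[ y < n ] (v z * (u y * f y z))   ≡⟨ wsum-nested v u (λ z y → f y z) ⟨
  wsum v (λ z → wsum u (λ y → f y z))           ∎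
  where open ≡-Reasoning

δ : ∀ {m} → Fin m → Fin m → ℕ
δ a b = [ does (a ≟ b) ]

δ-≢ : ∀ {m} {a b : Fin m} → a ≢ b → δ a b ≡ 0
δ-≢ {a = a} {b} a≢b = cong [_] (dec-false (a ≟ b) a≢b)

δ≤1 : ∀ {m} (a b : Fin m) → δ a b ≤ 1
δ≤1 a b = [b]≤1 (does (a ≟ b))

δ-cross≤1 : ∀ {m} {j k : Fin m} → j ≢ k → ∀ a b → δ a j * δ b k + δ a k * δ b j ≤ 1
δ-cross≤1 {j = j} {k} j≢k a b with a ≟ j
... | yes refl rewrite δ-≢ j≢k =
  ≤-trans (≤-reflexive (trans (+-identityʳ (1 * δ b k)) (*-identityˡ (δ b k)))) (δ≤1 b k)
... | no _ = *-mono-≤ (δ≤1 a k) (δ≤1 b j)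

∑-δ : ∀ (c : Fin 3) → ∑[ i < 3 ] δ c i ≡ 1
∑-δ 0F = refl
∑-δ 1F = refl
∑-δ 2F = refl

∑-Fin3 : ∀ (f : Fin 3 → ℕ) → ∑[ i < 3 ] f i ≡ f 0F + f 1F + f 2F
∑-Fin3 f = trans (cong (λ t → f 0F + (f 1F + t)) (+-identityʳ (f 2F)))
                 (sym (+-assoc (f 0F) (f 1F) (f 2F)))

∑∑-Fin3 : ∀ (E : Fin 3 → Fin 3 → ℕ) → (∀ i j → E i j ≡ E j i) → (∀ i → E i i ≡ 0) →
          ∑[ i < 3 ] ∑[ j < 3 ] E i j ≡ 2 * (E 0F 1F + E 0F 2F + E 1F 2F)
∑∑-Fin3 E E-sym E-diag
  rewrite E-diag 0F | E-diag 1F | E-diag 2F | E-sym 1F 0F | E-sym 2F 0F | E-sym 2F 1F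
  = regroup (E 0F 1F) (E 0F 2F) (E 1F 2F)
  where
  -- the nine terms of the unfolded double sum
  regroup : ∀ a b c → 0 + (a + (b + 0)) + (a + (0 + (c + 0)) + (b + (c + (0 + 0)) + 0))
                      ≡ 2 * (a + b + c)
  regroup = solve-∀

δ-permute : ∀ {m} (π : Permutation′ m) a b → δ (π ⟨$⟩ʳ a) b ≡ δ a (π ⟨$⟩ˡ b)
δ-permute π a b with π ⟨$⟩ʳ a ≟ b | a ≟ π ⟨$⟩ˡ b
... | yes _     | yes _      = refl
... | no _      | no _       = refl
... | yes πa≡b | no a≢π⁻¹b  = ⊥-elim (a≢π⁻¹b (trans (sym (inverseˡ π)) (cong (π ⟨$⟩ˡ_) πa≡b)))
... | no πa≢b  | yes a≡π⁻¹b = ⊥-elim (πa≢b (trans (cong (π ⟨$⟩ʳ_) a≡π⁻¹b) (inverseʳ π)))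

-- Graphs and their colour classes

∈⇒≤-foldr-⊔ : ∀ {A : Set} (f : A → ℕ) {x} {xs : List A} → x ∈ xs → f x ≤ foldr _⊔_ 0 (map f xs)
∈⇒≤-foldr-⊔ f {xs = y ∷ xs} (here refl) = m≤m⊔n (f y) _
∈⇒≤-foldr-⊔ f {xs = y ∷ xs} (there x∈xs) = ≤-trans (∈⇒≤-foldr-⊔ f x∈xs) (m≤n⊔m (f y) _)

tdeg≤tmax : ∀ (G : Graph n) x → tdeg G x ≤ tmax G
tdeg≤tmax G x = ∈⇒≤-foldr-⊔ (tdeg G) (∈-allFin x)

ProperColouring : Graph n → (Fin n → Fin 3) → Set
ProperColouring G col = ∀ x y → adj G x y ≡ true → col x ≡ col y → ⊥

module Classes (G : Graph n) (col : Fin n → Fin 3) where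

  A : Fin n → Fin n → ℕ
  A x y = [ adj G x y ]

  Δ : Fin n → Fin n → Fin n → ℕ
  Δ x y z = [ adj G x y ∧ adj G x z ∧ adj G y z ]

  χ : Fin 3 → Fin n → ℕ
  χ i x = δ (col x) i

  size : Fin 3 → ℕ
  size i = ∑[ x < n ] χ i x

  deg : Fin 3 → Fin n → ℕ
  deg j x = wsum (χ j) (A x)

  cross : Fin 3 → Fin 3 → ℕ
  cross i j = wsum (χ i) (deg j)

  A-sym : ∀ x y → A x y ≡ A y x
  A-sym x y = cong [_] (adj-sym G x y)

  Δ-sym : ∀ x y z → Δ x y z ≡ Δ x z y
  Δ-sym x y z = cong [_] (trans (cong (λ b → adj G x y ∧ adj G x z ∧ b) (adj-sym G y z))
                                (∧-swapˡ (adj G x y) (adj G x z) (adj G z y)))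

  Δ-diag : ∀ x y → Δ x y y ≡ 0
  Δ-diag x y = cong [_] (trans (cong (λ b → adj G x y ∧ adj G x y ∧ b) (irrefl G y))
                               (trans (cong (adj G x y ∧_) (∧-zeroʳ _)) (∧-zeroʳ _)))

  2*e≡∑∑A : 2 * e G ≡ ∑[ x < n ] ∑[ y < n ] A x y
  2*e≡∑∑A = begin
    2 * e G
      ≡⟨ cong (2 *_) (Σv²≡∑² (λ x y → [ (toℕ x <ᵇ toℕ y) ∧ adj G x y ])) ⟩
    2 * (∑[ x < n ] ∑[ y < n ] [ (toℕ x <ᵇ toℕ y) ∧ adj G x y ])
      ≡⟨ cong (2 *_) (sum-cong-≗ λ x → sum-cong-≗ λ y → [b∧c]≡[b]*[c] (toℕ x <ᵇ toℕ y) (adj G x y)) ⟩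
    2 * (∑[ x < n ] ∑[ y < n ] (lt x y * A x y))
      ≡⟨ ∑∑-symmetric A A-sym (λ x → cong [_] (irrefl G x)) ⟨
    ∑[ x < n ] ∑[ y < n ] A x y
      ∎
    where open ≡-Reasoning

  2*tdeg≡∑∑Δ : ∀ x → 2 * tdeg G x ≡ ∑[ y < n ] ∑[ z < n ] Δ x y z
  2*tdeg≡∑∑Δ x = begin
    2 * tdeg G x
      ≡⟨ cong (2 *_) (Σv²≡∑² (λ y z → [ (toℕ y <ᵇ toℕ z) ∧ adj G x y ∧ adj G x z ∧ adj G y z ])) ⟩
    2 * (∑[ y < n ] ∑[ z < n ] [ (toℕ y <ᵇ toℕ z) ∧ adj G x y ∧ adj G x z ∧ adj G y z ])
      ≡⟨ cong (2 *_) (sum-cong-≗ λ y → sum-cong-≗ λ z →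
           [b∧c]≡[b]*[c] (toℕ y <ᵇ toℕ z) (adj G x y ∧ adj G x z ∧ adj G y z)) ⟩
    2 * (∑[ y < n ] ∑[ z < n ] (lt y z * Δ x y z))
      ≡⟨ ∑∑-symmetric (Δ x) (Δ-sym x) (Δ-diag x) ⟨
    ∑[ y < n ] ∑[ z < n ] Δ x y z
      ∎
    where open ≡-Reasoning

  ∑-by-class : ∀ (f : Fin n → ℕ) → ∑[ x < n ] f x ≡ ∑[ i < 3 ] wsum (χ i) f
  ∑-by-class f = begin
    ∑[ x < n ] f x                         ≡⟨ sum-cong-≗ (λ x → split (col x) (f x)) ⟩
    ∑[ x < n ] ∑[ i < 3 ] (χ i x * f x)    ≡⟨ ∑-comm (λ x i → χ i x * f x) ⟩
    ∑[ i < 3 ] wsum (χ i) f                ∎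
    where
    open ≡-Reasoning
    split : ∀ c m → m ≡ ∑[ i < 3 ] (δ c i * m)
    split c m = trans (sym (trans (cong (_* m) (∑-δ c)) (*-identityˡ m))) (*-distribʳ-sum m (δ c))

  size-total : size 0F + size 1F + size 2F ≡ n
  size-total = begin
    size 0F + size 1F + size 2F       ≡⟨ ∑-Fin3 size ⟨
    ∑[ i < 3 ] size i                 ≡⟨ ∑-comm (λ i x → χ i x) ⟩
    ∑[ x < n ] ∑[ i < 3 ] χ i x       ≡⟨ sum-cong-≗ (λ x → ∑-δ (col x)) ⟩
    ∑[ x < n ] 1                      ≡⟨ ∑-const n 1 ⟩
    n * 1                             ≡⟨ *-identityʳ n ⟩
    n                                 ∎
    where open ≡-Reasoning

  cross-sym : ∀ i j → cross i j ≡ cross j i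
  cross-sym i j = trans (wsum-comm (χ i) (χ j) A)
    (sum-cong-≗ λ y → cong (χ j y *_) (sum-cong-≗ λ x → cong (χ i x *_) (A-sym x y)))

  cross-diag : ProperColouring G col → ∀ i → cross i i ≡ 0
  cross-diag proper i = trans (wsum-nested (χ i) (χ i) A)
    (trans (sum-cong-≗ λ x → trans (sum-cong-≗ (no-edge-inside x)) (sum-replicate-zero n))
           (sum-replicate-zero n))
    where
    no-edge-inside : ∀ x y → χ i x * (χ i y * A x y) ≡ 0
    no-edge-inside x y with col x ≟ i | col y ≟ i | adj G x y in x~y
    ... | no _     | _        | _     = refl
    ... | yes _    | no _     | _     = refl
    ... | yes _    | yes _    | false = refl
    ... | yes refl | yes cy≡cx | true = ⊥-elim (proper x y x~y (sym cy≡cx))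

  e≡cross : ProperColouring G col → e G ≡ cross 0F 1F + cross 0F 2F + cross 1F 2F
  e≡cross proper = *-cancelˡ-≡ (e G) _ 2 (begin
    2 * e G                                 ≡⟨ 2*e≡∑∑A ⟩
    ∑[ x < n ] ∑[ y < n ] A x y             ≡⟨ sum-cong-≗ (λ x → ∑-by-class (A x)) ⟩
    ∑[ x < n ] ∑[ j < 3 ] deg j x           ≡⟨ ∑-comm (λ x j → deg j x) ⟩
    ∑[ j < 3 ] ∑[ x < n ] deg j x           ≡⟨ sum-cong-≗ (λ j → ∑-by-class (deg j)) ⟩
    ∑[ j < 3 ] ∑[ i < 3 ] cross i j         ≡⟨ ∑-comm (λ j i → cross i j) ⟩
    ∑[ i < 3 ] ∑[ j < 3 ] cross i j         ≡⟨ ∑∑-Fin3 cross cross-sym (cross-diag proper) ⟩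
    2 * (cross 0F 1F + cross 0F 2F + cross 1F 2F) ∎)
    where open ≡-Reasoning

  cross≤size*size : ∀ i j → cross i j ≤ size i * size j
  cross≤size*size i j = begin
    cross i j                      ≤⟨ wsum-mono-≤ (χ i) (λ x → deg≤size x) ⟩
    wsum (χ i) (λ _ → size j)      ≡⟨ wsum-const (χ i) (size j) ⟩
    size i * size j                ∎
    where
    open ≤-Reasoning
    deg≤size : ∀ x → deg j x ≤ size j
    deg≤size x = begin
      wsum (χ j) (A x)           ≤⟨ wsum-mono-≤ (χ j) (λ y → [b]≤1 (adj G x y)) ⟩
      wsum (χ j) (λ _ → 1)       ≡⟨ wsum-const (χ j) 1 ⟩
      size j * 1                 ≡⟨ *-identityʳ (size j) ⟩
      size j                     ∎

  triangles-across : ∀ {j k} → j ≢ k → ∀ x → wsum (χ j) (λ y → wsum (χ k) (Δ x y)) ≤ tdeg G x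
  triangles-across {j} {k} j≢k x = *-cancelˡ-≤ 2 (begin
    2 * P j k
      ≡⟨ cong (P j k +_) (trans (+-identityʳ (P j k)) (sym Pkj≡Pjk)) ⟩
    P j k + P k j
      ≡⟨ cong₂ _+_ (wsum-nested (χ j) (χ k) (Δ x)) (wsum-nested (χ k) (χ j) (Δ x)) ⟩
    ∑[ y < n ] ∑[ z < n ] jk y z + ∑[ y < n ] ∑[ z < n ] kj y z
      ≡⟨ ∑∑-distrib-+ jk kj ⟨
    ∑[ y < n ] ∑[ z < n ] (jk y z + kj y z)
      ≤⟨ ∑-mono-≤ (λ y → ∑-mono-≤ (λ z → counted-once y z)) ⟩
    ∑[ y < n ] ∑[ z < n ] Δ x y z
      ≡⟨ 2*tdeg≡∑∑Δ x ⟨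
    2 * tdeg G x
      ∎)
    where
    open ≤-Reasoning
    P : Fin 3 → Fin 3 → ℕ
    P j k = wsum (χ j) (λ y → wsum (χ k) (Δ x y))
    jk kj : Fin n → Fin n → ℕ
    jk y z = χ j y * (χ k z * Δ x y z)
    kj y z = χ k y * (χ j z * Δ x y z)
    Pkj≡Pjk : P k j ≡ P j k
    Pkj≡Pjk = trans (wsum-comm (χ k) (χ j) (Δ x))
      (sum-cong-≗ λ y → cong (χ j y *_) (sum-cong-≗ λ z → cong (χ k z *_) (Δ-sym x z y)))
    factor : ∀ a b c d t → a * (b * t) + c * (d * t) ≡ (a * b + c * d) * t
    factor = solve-∀
    counted-once : ∀ y z → jk y z + kj y z ≤ Δ x y z
    counted-once y z = begin
      jk y z + kj y z
        ≡⟨ factor (χ j y) (χ k z) (χ k y) (χ j z) (Δ x y z) ⟩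
      (χ j y * χ k z + χ k y * χ j z) * Δ x y z
        ≤⟨ *-monoˡ-≤ (Δ x y z) (δ-cross≤1 j≢k (col y) (col z)) ⟩
      1 * Δ x y z                      ≡⟨ *-identityˡ (Δ x y z) ⟩
      Δ x y z                          ∎

  vertex-count : ∀ {j k} → j ≢ k → ∀ x →
    size k * deg j x + size j * deg k x + cross j k ≤ size j * (size k * 2) + tdeg G x
  vertex-count {j} {k} j≢k x = begin
    size k * deg j x + size j * deg k x + cross j k
      ≡⟨ edges-on-pairs ⟨
    wsum (χ j) (λ y → wsum (χ k) (λ z → A x y + A x z + A y z))
      ≤⟨ wsum-mono-≤ (χ j) (λ y → wsum-mono-≤ (χ k) (λ z →
           [p]+[q]+[r]≤2+[p∧q∧r] (adj G x y) (adj G x z) (adj G y z))) ⟩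
    wsum (χ j) (λ y → wsum (χ k) (λ z → 2 + Δ x y z))
      ≡⟨ pairs ⟩
    size j * (size k * 2) + wsum (χ j) (λ y → wsum (χ k) (Δ x y))
      ≤⟨ +-monoʳ-≤ (size j * (size k * 2)) (triangles-across j≢k x) ⟩
    size j * (size k * 2) + tdeg G x   ∎
    where
    open ≤-Reasoning
    edges-from : ∀ y → wsum (χ k) (λ z → A x y + A x z + A y z)
                     ≡ size k * A x y + deg k x + deg k y
    edges-from y = trans (wsum-distrib-+ (χ k) (λ z → A x y + A x z) (A y))
      (cong (_+ deg k y) (trans (wsum-distrib-+ (χ k) (λ _ → A x y) (A x))
                                (cong (_+ deg k x) (wsum-const (χ k) (A x y)))))
    edges-on-pairs : wsum (χ j) (λ y → wsum (χ k) (λ z → A x y + A x z + A y z))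
                   ≡ size k * deg j x + size j * deg k x + cross j k
    edges-on-pairs = trans (sum-cong-≗ λ y → cong (χ j y *_) (edges-from y))
      (trans (wsum-distrib-+ (χ j) (λ y → size k * A x y + deg k x) (deg k))
        (cong (_+ cross j k) (trans (wsum-distrib-+ (χ j) (λ y → size k * A x y) (λ _ → deg k x))
          (cong₂ _+_ (wsum-scale (χ j) (size k) (A x)) (wsum-const (χ j) (deg k x))))))
    pairs : wsum (χ j) (λ y → wsum (χ k) (λ z → 2 + Δ x y z))
          ≡ size j * (size k * 2) + wsum (χ j) (λ y → wsum (χ k) (Δ x y))
    pairs = trans (sum-cong-≗ λ y → cong (χ j y *_)
                    (trans (wsum-distrib-+ (χ k) (λ _ → 2) (Δ x y))
                           (cong (_+ wsum (χ k) (Δ x y)) (wsum-const (χ k) 2))))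
      (trans (wsum-distrib-+ (χ j) (λ _ → size k * 2) (λ y → wsum (χ k) (Δ x y)))
        (cong (_+ wsum (χ j) (λ y → wsum (χ k) (Δ x y))) (wsum-const (χ j) (size k * 2))))

  class-count : ∀ {j k} → j ≢ k → ∀ i →
    size k * cross i j + size j * cross i k + size i * cross j k
    ≤ 2 * (size i * (size j * size k)) + size i * tmax G
  class-count {j} {k} j≢k i = begin
    size k * cross i j + size j * cross i k + size i * cross j k
      ≡⟨ expand ⟨
    wsum (χ i) (λ x → size k * deg j x + size j * deg k x + cross j k)
      ≤⟨ wsum-mono-≤ (χ i) (λ x →
           ≤-trans (vertex-count j≢k x) (+-monoʳ-≤ (size j * (size k * 2)) (tdeg≤tmax G x))) ⟩
    wsum (χ i) (λ _ → size j * (size k * 2) + tmax G)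
      ≡⟨ wsum-const (χ i) (size j * (size k * 2) + tmax G) ⟩
    size i * (size j * (size k * 2) + tmax G)
      ≡⟨ regroup (size i) (size j) (size k) (tmax G) ⟩
    2 * (size i * (size j * size k)) + size i * tmax G ∎
    where
    open ≤-Reasoning
    regroup : ∀ a b c t → a * (b * (c * 2) + t) ≡ 2 * (a * (b * c)) + a * t
    regroup = solve-∀
    expand : wsum (χ i) (λ x → size k * deg j x + size j * deg k x + cross j k)
           ≡ size k * cross i j + size j * cross i k + size i * cross j k
    expand =
      trans (wsum-distrib-+ (χ i) (λ x → size k * deg j x + size j * deg k x) (λ _ → cross j k))
        (cong₂ _+_ (trans (wsum-distrib-+ (χ i) (λ x → size k * deg j x) (λ x → size j * deg k x))
                          (cong₂ _+_ (wsum-scale (χ i) (size k) (deg j))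
                                     (wsum-scale (χ i) (size j) (deg k))))
                   (wsum-const (χ i) (cross j k)))

module _ (G : Graph n) (col : Fin n → Fin 3) (π : Permutation′ 3) where
  open Classes G using (size)

  size-permute : ∀ i → size ((π ⟨$⟩ʳ_) ∘ col) i ≡ size col (π ⟨$⟩ˡ i)
  size-permute i = sum-cong-≗ (λ x → δ-permute π (col x) i)

  proper-permute : ProperColouring G col → ProperColouring G ((π ⟨$⟩ʳ_) ∘ col)
  proper-permute proper x y x~y πcx≡πcy =
    proper x y x~y (trans (sym (inverseˡ π)) (trans (cong (π ⟨$⟩ˡ_) πcx≡πcy) (inverseˡ π)))

sorting-permutation : ∀ (f : Fin 3 → ℕ) →
  ∃ λ (π : Permutation′ 3) → f (π ⟨$⟩ˡ 0F) ≤ f (π ⟨$⟩ˡ 1F) × f (π ⟨$⟩ˡ 1F) ≤ f (π ⟨$⟩ˡ 2F)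
sorting-permutation f with ≤-total (f 0F) (f 1F) | ≤-total (f 1F) (f 2F) | ≤-total (f 0F) (f 2F)
... | inj₁ f0≤f1 | inj₁ f1≤f2 | _          = Perm.id , f0≤f1 , f1≤f2
... | inj₁ f0≤f1 | inj₂ f2≤f1 | inj₁ f0≤f2 = transpose 1F 2F , f0≤f2 , f2≤f1
... | inj₁ f0≤f1 | inj₂ f2≤f1 | inj₂ f2≤f0 = transpose 0F 1F ∘ₚ transpose 0F 2F , f2≤f0 , f0≤f1
... | inj₂ f1≤f0 | inj₁ f1≤f2 | inj₁ f0≤f2 = transpose 0F 1F , f1≤f0 , f0≤f2
... | inj₂ f1≤f0 | inj₁ f1≤f2 | inj₂ f2≤f0 = transpose 0F 2F ∘ₚ transpose 0F 1F , f1≤f2 , f2≤f0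
... | inj₂ f1≤f0 | inj₂ f2≤f1 | _          = transpose 0F 2F , f2≤f1 , f1≤f0

sorted-colouring : ∀ (G : Graph n) {col} → ProperColouring G col →
  ∃ λ col′ → let open Classes G col′ in
    ProperColouring G col′ × size 0F ≤ size 1F × size 1F ≤ size 2F
sorted-colouring G {col} proper with sorting-permutation (Classes.size G col)
... | π , s0≤s1 , s1≤s2 =
  (π ⟨$⟩ʳ_) ∘ col , proper-permute G col π proper ,
  subst₂ _≤_ (sym (size-permute G col π 0F)) (sym (size-permute G col π 1F)) s0≤s1 ,
  subst₂ _≤_ (sym (size-permute G col π 1F)) (sym (size-permute G col π 2F)) s1≤s2

-- Arithmetic

TriangleBounds : ℕ → ℕ → ℕ → Set
TriangleBounds n e t =
  (10 * e < 3 * (n * n) → 12 * e ≤ 8 * t + 3 * (n * n)) ×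
  (3 * (n * n) ≤ 10 * e → 3 * e ≤ n * n → 9 * e ≤ 9 * t + 2 * (n * n))

≤-residue : ∀ {m o} k → m + k ≡ o → m ≤ o
≤-residue k refl = m≤m+n _ k

4mn≤[m+n]² : ∀ m n → 4 * (m * n) ≤ (m + n) * (m + n)
4mn≤[m+n]² m n = [ ordered , swapped ]′ (≤-total m n)
  where
  ordered : ∀ {m n} → m ≤ n → 4 * (m * n) ≤ (m + n) * (m + n)
  ordered {m} m≤n with m≤n⇒∃[o]m+o≡n m≤n
  ... | d , refl = ≤-residue (d * d) (solve (m ∷ d ∷ []))
  swapped : n ≤ m → 4 * (m * n) ≤ (m + n) * (m + n)
  swapped n≤m =
    subst₂ _≤_ (cong (4 *_) (*-comm n m)) (cong (λ k → k * k) (+-comm n m)) (ordered n≤m)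

c*e≤a*t+c²[a+b] : ∀ {a b c X Y Z t} → a ≤ b → b ≤ c → Y ≤ a * c → Z ≤ b * c →
  c * X + b * Y + a * Z ≤ 2 * (a * (b * c)) + a * t → c * (X + Y + Z) ≤ a * t + c * c * (a + b)
c*e≤a*t+c²[a+b] {a} {X = X} {Y} {Z} {t} a≤b b≤c Y≤ac Z≤bc count
  with m≤n⇒∃[o]m+o≡n a≤b | m≤n⇒∃[o]m+o≡n b≤c
... | q , refl | u , refl = begin
  (a + q + u) * (X + Y + Z)
    ≡⟨ solve (a ∷ q ∷ u ∷ X ∷ Y ∷ Z ∷ []) ⟩
  ((a + q + u) * X + (a + q) * Y + a * Z) + (u * Y + (q + u) * Z)
    ≤⟨ +-mono-≤ count (+-mono-≤ (*-monoʳ-≤ u Y≤ac) (*-monoʳ-≤ (q + u) Z≤bc)) ⟩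
  (2 * (a * ((a + q) * (a + q + u))) + a * t)
    + (u * (a * (a + q + u)) + (q + u) * ((a + q) * (a + q + u)))
    ≡⟨ solve (a ∷ q ∷ u ∷ t ∷ []) ⟩
  a * t + (a + q + u) * (a + q + u) * (a + (a + q)) ∎
  where open ≤-Reasoning

bounds-if-4e≤n² : ∀ {n e} t → 4 * e ≤ n * n → TriangleBounds n e t
bounds-if-4e≤n² {n} {e} t 4e≤N = sparse , dense
  where
  N = n * n
  sparse : 10 * e < 3 * N → 12 * e ≤ 8 * t + 3 * N
  sparse _ = begin
    12 * e       ≡⟨ *-assoc 3 4 e ⟩
    3 * (4 * e)  ≤⟨ *-monoʳ-≤ 3 4e≤N ⟩
    3 * N        ≤⟨ m≤n+m (3 * N) (8 * t) ⟩
    8 * t + 3 * N ∎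
    where open ≤-Reasoning
  dense : 3 * N ≤ 10 * e → 3 * e ≤ N → 9 * e ≤ 9 * t + 2 * N
  dense 3N≤10e _ = subst (λ k → 9 * k ≤ 9 * t + 2 * N) (sym e≡0) z≤n
    where
    open ≤-Reasoning
    10e+2e≤10e+0 : 10 * e + 2 * e ≤ 10 * e + 0
    10e+2e≤10e+0 = begin
      10 * e + 2 * e  ≡⟨ solve (e ∷ []) ⟩
      3 * (4 * e)     ≤⟨ *-monoʳ-≤ 3 4e≤N ⟩
      3 * N           ≤⟨ 3N≤10e ⟩
      10 * e          ≡⟨ +-identityʳ (10 * e) ⟨
      10 * e + 0      ∎
    e≡0 : e ≡ 0
    e≡0 = n≤0⇒n≡0 (≤-trans (m≤m+n e (e + 0)) (+-cancelˡ-≤ (10 * e) _ _ 10e+2e≤10e+0))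

dense-poly : ∀ a q u → let b = a + q; c = a + (q + u); n = a + b + c in
  90 * (c * c * (a + b)) ≤ (20 * a + 27 * (q + u)) * (n * n)
dense-poly a q u = ≤-residue
  (27 * u * u * u + 45 * q * u * u + 36 * q * q * u + 18 * q * q * q + 2 * a * u * u
   + 26 * a * q * u + 44 * a * q * q + 3 * a * a * u + 33 * a * a * q)
  (solve (a ∷ q ∷ u ∷ []))

sparse-poly : ∀ q u s → let a = 2 * (q + u) + s; b = a + q; c = a + (q + u); n = a + b + c in
  80 * (c * c * (a + b)) + 12 * s * (n * n) ≤ 30 * a * (n * n)
sparse-poly q u s = ≤-residue
  (2 * s * s * s + 16 * u * s * s + 42 * u * u * s + 60 * u * u * u + 44 * q * s * s
   + 216 * q * u * s + 300 * q * u * u + 192 * q * q * s + 480 * q * q * u + 240 * q * q * q)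
  (solve (q ∷ u ∷ s ∷ []))

dense-step : ∀ a d C N e t .{{_ : NonZero a}} →
  90 * C ≤ (20 * a + 27 * d) * N → 3 * N ≤ 10 * e → (a + d) * e ≤ a * t + C →
  9 * e ≤ 9 * t + 2 * N
dense-step a d C N e t poly 3N≤10e key =
  *-cancelˡ-≤ (10 * a) {{m*n≢0 10 a}} (+-cancelʳ-≤ (90 * C) _ _ (begin
    10 * a * (9 * e) + 90 * C                       ≤⟨ +-monoʳ-≤ (10 * a * (9 * e)) poly ⟩
    10 * a * (9 * e) + (20 * a + 27 * d) * N        ≡⟨ solve (a ∷ d ∷ N ∷ e ∷ []) ⟩
    20 * a * N + (90 * (a * e) + 9 * d * (3 * N))
      ≤⟨ +-monoʳ-≤ (20 * a * N) (+-monoʳ-≤ (90 * (a * e)) (*-monoʳ-≤ (9 * d) 3N≤10e)) ⟩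
    20 * a * N + (90 * (a * e) + 9 * d * (10 * e))  ≡⟨ solve (a ∷ d ∷ N ∷ e ∷ []) ⟩
    20 * a * N + 90 * ((a + d) * e)                 ≤⟨ +-monoʳ-≤ (20 * a * N) (*-monoʳ-≤ 90 key) ⟩
    20 * a * N + 90 * (a * t + C)                   ≡⟨ solve (a ∷ N ∷ t ∷ C ∷ []) ⟩
    10 * a * (9 * t + 2 * N) + 90 * C               ∎))
  where open ≤-Reasoning

sparse-step : ∀ a d s C N e t .{{_ : NonZero a}} → a ≡ 2 * d + s →
  80 * C + 12 * s * N ≤ 30 * a * N → 10 * e ≤ 3 * N → (a + d) * e ≤ a * t + C →
  12 * e ≤ 8 * t + 3 * N
sparse-step a d s C N e t a≡2d+s poly 10e≤3N key = *-cancelˡ-≤ (10 * a) {{m*n≢0 10 a}} (begin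
  10 * a * (12 * e)                          ≡⟨ solve (a ∷ e ∷ []) ⟩
  80 * (a * e) + 40 * (a * e)                ≡⟨ cong (λ k → 80 * (a * e) + 40 * (k * e)) a≡2d+s ⟩
  80 * (a * e) + 40 * ((2 * d + s) * e)      ≡⟨ solve (a ∷ d ∷ s ∷ e ∷ []) ⟩
  80 * ((a + d) * e) + 4 * s * (10 * e)      ≤⟨ +-mono-≤ (*-monoʳ-≤ 80 key) (*-monoʳ-≤ (4 * s) 10e≤3N) ⟩
  80 * (a * t + C) + 4 * s * (3 * N)         ≡⟨ solve (a ∷ s ∷ C ∷ N ∷ t ∷ []) ⟩
  80 * (a * t) + (80 * C + 12 * s * N)       ≤⟨ +-monoʳ-≤ (80 * (a * t)) poly ⟩
  80 * (a * t) + 30 * a * N                  ≡⟨ solve (a ∷ N ∷ t ∷ []) ⟩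
  10 * a * (8 * t + 3 * N)                   ∎)
  where open ≤-Reasoning

excess-step : ∀ a d w t .{{_ : NonZero a}} → a ≤ 2 * d → (a + d) * w ≤ a * t → 12 * w ≤ 8 * t
excess-step a d w t a≤2d key = *-cancelˡ-≤ a (begin
  a * (12 * w)                      ≡⟨ solve (a ∷ w ∷ []) ⟩
  8 * (a * w) + 4 * (a * w)         ≤⟨ +-monoʳ-≤ (8 * (a * w)) (*-monoʳ-≤ 4 (*-monoˡ-≤ w a≤2d)) ⟩
  8 * (a * w) + 4 * (2 * d * w)     ≡⟨ solve (a ∷ d ∷ w ∷ []) ⟩
  8 * ((a + d) * w)                 ≤⟨ *-monoʳ-≤ 8 key ⟩
  8 * (a * t)                       ≡⟨ solve (a ∷ t ∷ []) ⟩
  a * (8 * t)                       ∎)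
  where open ≤-Reasoning

sparse-small-step : ∀ a d P e t .{{_ : NonZero a}} → a ≤ 2 * d → (a + d) * e ≤ a * t + (a + d) * P →
                    12 * e ≤ 8 * t + 12 * P
sparse-small-step a d P e t a≤2d key with ≤-total e P
... | inj₁ e≤P = ≤-trans (*-monoʳ-≤ 12 e≤P) (m≤n+m (12 * P) (8 * t))
... | inj₂ P≤e with m≤n⇒∃[o]m+o≡n P≤e
...   | w , refl = begin
  12 * (P + w)       ≡⟨ solve (P ∷ w ∷ []) ⟩
  12 * w + 12 * P    ≤⟨ +-monoˡ-≤ (12 * P) (excess-step a d w t a≤2d excess-key) ⟩
  8 * t + 12 * P     ∎
  where
  open ≤-Reasoning
  excess-key : (a + d) * w ≤ a * t
  excess-key = +-cancelˡ-≤ ((a + d) * P) _ _ (begin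
    (a + d) * P + (a + d) * w    ≡⟨ *-distribˡ-+ (a + d) P w ⟨
    (a + d) * (P + w)            ≤⟨ key ⟩
    a * t + (a + d) * P          ≡⟨ +-comm (a * t) ((a + d) * P) ⟩
    (a + d) * P + a * t          ∎)

triangle-bounds-nonempty : ∀ {a b c e} t .{{_ : NonZero a}} → a ≤ b → b ≤ c →
  c * e ≤ a * t + c * c * (a + b) → TriangleBounds (a + b + c) e t
triangle-bounds-nonempty {a} {e = e} t a≤b b≤c key
  with m≤n⇒∃[o]m+o≡n a≤b | m≤n⇒∃[o]m+o≡n (≤-trans a≤b b≤c)
... | q , refl | d , refl with m≤n⇒∃[o]m+o≡n (+-cancelˡ-≤ a q d b≤c)
... | u , refl = sparse , dense
  where
  b = a + q
  c = a + (q + u)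
  N = (a + b + c) * (a + b + c)
  dense : 3 * N ≤ 10 * e → 3 * e ≤ N → 9 * e ≤ 9 * t + 2 * N
  dense 3N≤10e _ = dense-step a (q + u) (c * c * (a + b)) N e t (dense-poly a q u) 3N≤10e key
  -- a ≤ 2 (q + u) is 3a ≤ 2c.
  small-a : a ≤ 2 * (q + u) → 12 * e ≤ 8 * t + 3 * N
  small-a a≤2d = begin
    12 * e
      ≤⟨ sparse-small-step a (q + u) (c * (a + b)) e t a≤2d
           (subst (λ k → c * e ≤ a * t + k) (*-assoc c c (a + b)) key) ⟩
    8 * t + 12 * (c * (a + b))
      ≡⟨ cong (8 * t +_) (trans (cong (12 *_) (*-comm c (a + b))) (*-assoc 3 4 ((a + b) * c))) ⟩
    8 * t + 3 * (4 * ((a + b) * c))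
      ≤⟨ +-monoʳ-≤ (8 * t) (*-monoʳ-≤ 3 (4mn≤[m+n]² (a + b) c)) ⟩
    8 * t + 3 * N
      ∎
    where open ≤-Reasoning
  large-a : ∀ s → 2 * (q + u) + s ≡ a → 10 * e ≤ 3 * N → 12 * e ≤ 8 * t + 3 * N
  large-a s refl 10e≤3N =
    sparse-step a (q + u) s (c * c * (a + b)) N e t refl (sparse-poly q u s) 10e≤3N key
  sparse : 10 * e < 3 * N → 12 * e ≤ 8 * t + 3 * N
  sparse 10e<3N with ≤-total a (2 * (q + u))
  ... | inj₁ a≤2d = small-a a≤2d
  ... | inj₂ 2d≤a with m≤n⇒∃[o]m+o≡n 2d≤a
  ...   | s , 2d+s≡a = large-a s 2d+s≡a (<⇒≤ 10e<3N)

triangle-bounds : ∀ {a b c e} t → a ≤ b → b ≤ c → e ≤ a * b + a * c + b * c →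
                  c * e ≤ a * t + c * c * (a + b) → TriangleBounds (a + b + c) e t
triangle-bounds {zero} {b} {c} {e} t _ _ e≤bc _ =
  bounds-if-4e≤n² {b + c} {e} t (≤-trans (*-monoʳ-≤ 4 e≤bc) (4mn≤[m+n]² b c))
triangle-bounds {suc _} t a≤b b≤c _ key = triangle-bounds-nonempty t a≤b b≤c key

theorem1p6 : ∀ (n : ℕ) (G : Graph n) → Tripartite G →
    (10 * e G < 3 * (n * n) → 12 * e G ≤ 8 * tmax G + 3 * (n * n)) ×
    (3 * (n * n) ≤ 10 * e G → 3 * e G ≤ n * n → 9 * e G ≤ 9 * tmax G + 2 * (n * n))
theorem1p6 n G (col , proper) with sorted-colouring G proper
... | col′ , proper′ , a≤b , b≤c =
  subst₂ (λ m k → TriangleBounds m k (tmax G)) size-total (sym (e≡cross proper′))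
    (triangle-bounds (tmax G) a≤b b≤c
      (+-mono-≤ (+-mono-≤ (cross≤size*size 0F 1F) (cross≤size*size 0F 2F)) (cross≤size*size 1F 2F))
      (c*e≤a*t+c²[a+b] a≤b b≤c (cross≤size*size 0F 2F) (cross≤size*size 1F 2F) (class-count (λ ()) 0F)))
  where open Classes G col′
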